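{- Let $G$ be a graph with $n$ vertices and $S(G)=3$. Then $$|E(G)|\le\begin{cases}\frac{3}{2}n-2 & \text{if } n \text{ is even},\\ \frac{3}{2}n-\frac{3}{2} & \text{if } n\text{ is odd}.\end{cases}$$ Moreover, for every $n\ge 3$ there is a graph $G$ with $n$ vertices and $S(G)=3$ attaining equality.
   Context: For a finite simple graph $G=(V,E)$ and an injective map $f:V\to\mathbb Z$, let $\sigma(G,f)=\{f(v)+f(w): vw\in E\}$. The sum index of $G$ is $S(G)=\min_{f}|\sigma(G,f)|$ over all injective $f:V\to\mathbb Z$. -}

module Defs where

open import Data.Bool using (Bool; true; false; _∧_)
open import Data.Nat using (ℕ; _<ᵇ_)
open import Data.Fin using (Fin; toℕ)
open import Data.Integer using (ℤ; _+_) renaming (_≟_ to _≟ℤ_)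
open import Data.List using (List; length; map; filterᵇ; cartesianProduct; deduplicate; allFin)
open import Data.Product using (_×_; _,_; Σ; proj₁; proj₂)
open import Function.Definitions using (Injective)
open import Relation.Binary.PropositionalEquality using (_≡_)
open import Data.Nat using (_≤_)

record SimpleGraph (n : ℕ) : Set where
  field
    adj    : Fin n → Fin n → Bool
    sym    : ∀ i j → adj i j ≡ adj j i
    irrefl : ∀ i → adj i i ≡ false
open SimpleGraph public

edges : ∀ {n} → SimpleGraph n → List (Fin n × Fin n)
edges {n} G = filterᵇ (λ p → (toℕ (proj₁ p) <ᵇ toℕ (proj₂ p)) ∧ adj G (proj₁ p) (proj₂ p))
                      (cartesianProduct (allFin n) (allFin n))

numEdges : ∀ {n} → SimpleGraph n → ℕ
numEdges G = length (edges G)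

sumSetSize : ∀ {n} → SimpleGraph n → (Fin n → ℤ) → ℕ
sumSetSize G f = length (deduplicate _≟ℤ_ (map (λ p → f (proj₁ p) + f (proj₂ p)) (edges G)))

HasSumIndex : ∀ {n} → SimpleGraph n → ℕ → Set
HasSumIndex {n} G s =
  (Σ (Fin n → ℤ) λ f → Injective _≡_ _≡_ f × sumSetSize G f ≡ s)
  × (∀ (f : Fin n → ℤ) → Injective _≡_ _≡_ f → s ≤ sumSetSize G f)

{-# OPTIONS --safe #-}
module Submission where

-- For an injective labelling f, the edges whose end labels sum to a given t form a matching, so each
-- of the s sum classes has at most ⌊n/2⌋ edges.  When n is even, a class can only be a perfect
-- matching if t = max f + min f (the partner of the vertex of largest label shows t ≥ max f + min f,
-- that of the vertex of smallest label shows t ≤ max f + min f), so all classes but one have at most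
-- n/2 - 1 edges.  Hence |E| ≤ s⌊n/2⌋, and |E| ≤ s(n/2 - 1) + 1 for even n; with s = 3 this is the bound.
--
-- The extremal graphs grow from K₁ or K₂: if the vertex u of largest and w of smallest label have
-- labels summing to c and every edge sum lies in {c - 1, c, c + 1}, then adding a path u - x - y - w
-- with labels f w - 1 at x and f u + 1 at y keeps this invariant and adds three edges.  These graphs
-- meet the bound above for s = 3, so the same bound rules out every labelling with fewer sums.

open import Defs renaming (sym to adj-sym)
open import Data.Nat using (ℕ; zero; suc; _+_; _*_; _≤_; _<_; _%_; _<ᵇ_; z≤n; s≤s) renaming (_≟_ to _≟ℕ_)
open import Data.Product using (_×_; Σ; _,_; proj₂; ∃)
open import Relation.Binary.PropositionalEquality
  using (_≡_; _≢_; refl; sym; trans; cong; cong₂; subst; module ≡-Reasoning)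

open import Data.Bool using (Bool; true; false; _∧_; T)
open import Data.Bool.Properties using (∧-assoc; T-∧)
open import Data.Empty using (⊥; ⊥-elim)
open import Data.Fin using (Fin; zero; suc; toℕ)
open import Data.Fin.Patterns using (0F; 1F)
open import Data.Fin.Properties using (suc-injective; any?) renaming (_≟_ to _≟ᶠ_)
open import Data.Integer as ℤ using (ℤ; 0ℤ; 1ℤ; -1ℤ) renaming (_≟_ to _≟ℤ_)
import Data.Integer.Properties as ℤₚ
open import Algebra.Properties.AbelianGroup ℤₚ.+-0-abelianGroup using (∙-cancelˡ)
open import Data.Integer.Tactic.RingSolver using () renaming (solve-∀ to ℤ-solve-∀)
open import Data.List
  using (List; []; _∷_; _++_; length; map; filterᵇ; tabulate; allFin; cartesianProduct; deduplicate)
open import Data.List.Extrema ℤₚ.≤-totalOrder using (argmax; argmin; f[xs]≤f[argmax]; f[argmin]≤f[xs])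
open import Data.List.Membership.Propositional using (_∈_)
open import Data.List.Membership.Propositional.Properties
  using (∈-allFin; ∈-map⁺; ∈-map⁻; ∈-filter⁻; ∈-deduplicate⁺; ∈-deduplicate⁻; ∈-∃++; ∈-++⁻; ∈-++⁺ˡ; ∈-++⁺ʳ)
open import Data.List.Properties using (length-++; length-++-sucʳ; filter-++; map-cong)
open import Data.List.Relation.Unary.All as All using (All; []; _∷_)
open import Data.List.Relation.Unary.AllPairs using ([]; _∷_)
open import Data.List.Relation.Unary.Any using (here; there)
open import Data.List.Relation.Unary.Unique.Propositional using (Unique)
open import Data.List.Relation.Unary.Unique.DecPropositional.Properties using (deduplicate-!)
open import Data.Nat.DivMod using (m*n%n≡0; [m+kn]%n≡m%n)
open import Data.Nat.ListAction using (sum)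
open import Data.Nat.Properties
  using (+-0-commutativeMonoid; ≤-refl; ≤-trans; ≤-reflexive; ≤-pred; ≤-antisym; ≤-<-trans; <-asym; <ᵇ⇒<;
         +-mono-≤; +-mono-≤-<; +-monoˡ-≤; *-monoʳ-≤; m≤n+m; +-identityʳ; +-suc; *-comm; *-cancelʳ-≤; *-cancelʳ-<)
  renaming (module ≤-Reasoning to ℕ-Reasoning)
open import Algebra.Properties.CommutativeMonoid.Sum +-0-commutativeMonoid
  using (sum-syntax; ∑-comm; ∑-distrib-+; sum-cong-≗)
open import Data.Nat.Tactic.RingSolver using (solve-∀)
open import Data.Sum using (_⊎_; inj₁; inj₂; [_,_])
open import Data.Unit using (tt)
open import Function using (_∘_; id; Equivalence)
open import Function.Definitions using (Injective)
open import Relation.Binary.Definitions using (DecidableEquality)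
open import Relation.Nullary using (Dec; yes; no; does; ¬_; contradiction)

⟦_⟧ : Bool → ℕ
⟦ true ⟧ = 1
⟦ false ⟧ = 0

T-does : ∀ {A : Set} (a? : Dec A) → T (does a?) → A
T-does (yes a) _ = a

⟦∧⟧+⟦∧⟧≤⟦⟧ : ∀ x y b → (T x → T y → ⊥) → ⟦ x ∧ b ⟧ + ⟦ y ∧ b ⟧ ≤ ⟦ b ⟧
⟦∧⟧+⟦∧⟧≤⟦⟧ true  true  b x⇒¬y = ⊥-elim (x⇒¬y tt tt)
⟦∧⟧+⟦∧⟧≤⟦⟧ true  false b _ = ≤-reflexive (+-identityʳ ⟦ b ⟧)
⟦∧⟧+⟦∧⟧≤⟦⟧ false true  b _ = ≤-refl
⟦∧⟧+⟦∧⟧≤⟦⟧ false false b _ = z≤n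

∑-mono-≤ : ∀ {n} {f g : Fin n → ℕ} → (∀ i → f i ≤ g i) → ∑[ i < n ] f i ≤ ∑[ i < n ] g i
∑-mono-≤ {zero}  _   = z≤n
∑-mono-≤ {suc n} f≤g = +-mono-≤ (f≤g zero) (∑-mono-≤ (f≤g ∘ suc))

∑-≤1⇒≤n : ∀ {n} {f : Fin n → ℕ} → (∀ i → f i ≤ 1) → ∑[ i < n ] f i ≤ n
∑-≤1⇒≤n {zero}  _   = z≤n
∑-≤1⇒≤n {suc n} f≤1 = +-mono-≤ (f≤1 zero) (∑-≤1⇒≤n (f≤1 ∘ suc))

∑-≤1⇒<n : ∀ {n} {f : Fin n → ℕ} → (∀ i → f i ≤ 1) → ∀ i → f i ≡ 0 → ∑[ i < n ] f i < n
∑-≤1⇒<n {suc n} f≤1 zero    fi≡0 rewrite fi≡0 = s≤s (∑-≤1⇒≤n (f≤1 ∘ suc))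
∑-≤1⇒<n {suc n} f≤1 (suc i) fi≡0 = +-mono-≤-< (f≤1 zero) (∑-≤1⇒<n (f≤1 ∘ suc) i fi≡0)

∑⟦⟧≡0 : ∀ {n} (p : Fin n → Bool) → (∀ j → ¬ T (p j)) → ∑[ j < n ] ⟦ p j ⟧ ≡ 0
∑⟦⟧≡0 {zero}  p _  = refl
∑⟦⟧≡0 {suc n} p ¬p with p zero in eq
... | true  = ⊥-elim (¬p zero (subst T (sym eq) tt))
... | false = ∑⟦⟧≡0 (p ∘ suc) (¬p ∘ suc)

∑⟦⟧≤1 : ∀ {n} (p : Fin n → Bool) → (∀ {j k} → T (p j) → T (p k) → j ≡ k) → ∑[ j < n ] ⟦ p j ⟧ ≤ 1
∑⟦⟧≤1 {zero}  p _       = z≤n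
∑⟦⟧≤1 {suc n} p p-unique with p zero in eq
... | true  = ≤-reflexive (cong suc (∑⟦⟧≡0 (p ∘ suc) λ j pj → 0≢suc (p-unique (subst T (sym eq) tt) pj)))
  where
  0≢suc : ∀ {j : Fin n} → zero ≢ suc j
  0≢suc ()
... | false = ∑⟦⟧≤1 (p ∘ suc) (λ pj pk → suc-injective (p-unique pj pk))

∑⟦⟧≢0⇒∃ : ∀ {n} (p : Fin n → Bool) → ∑[ j < n ] ⟦ p j ⟧ ≢ 0 → ∃ λ j → T (p j)
∑⟦⟧≢0⇒∃ {zero}  p ∑≢0 = contradiction refl ∑≢0
∑⟦⟧≢0⇒∃ {suc n} p ∑≢0 with p zero in eq
... | true  = zero , subst T (sym eq) tt
... | false = let j , pj = ∑⟦⟧≢0⇒∃ (p ∘ suc) ∑≢0 in suc j , pj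

∑⟦≟⟧≡1 : ∀ {n} (w : Fin n) → ∑[ j < n ] ⟦ does (j ≟ᶠ w) ⟧ ≡ 1
∑⟦≟⟧≡1 {suc n} zero = cong suc (∑⟦⟧≡0 {n} _ λ _ ())
∑⟦≟⟧≡1 (suc w)      = ∑⟦≟⟧≡1 w

length-filterᵇ-∷ : ∀ {A : Set} (p : A → Bool) x xs →
                   length (filterᵇ p (x ∷ xs)) ≡ ⟦ p x ⟧ + length (filterᵇ p xs)
length-filterᵇ-∷ p x xs with p x
... | true  = refl
... | false = refl

length-filterᵇ-++ : ∀ {A : Set} (p : A → Bool) xs ys →
                    length (filterᵇ p (xs ++ ys)) ≡ length (filterᵇ p xs) + length (filterᵇ p ys)
length-filterᵇ-++ p xs ys = trans (cong length (filter-++ _ xs ys)) (length-++ (filterᵇ p xs))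

length-filterᵇ-map : ∀ {A B : Set} (p : B → Bool) (g : A → B) xs →
                     length (filterᵇ p (map g xs)) ≡ length (filterᵇ (p ∘ g) xs)
length-filterᵇ-map p g []       = refl
length-filterᵇ-map p g (x ∷ xs) with p (g x)
... | true  = cong suc (length-filterᵇ-map p g xs)
... | false = length-filterᵇ-map p g xs

length-filterᵇ-filterᵇ : ∀ {A : Set} (p q r : A → Bool) → (∀ x → p x ∧ q x ≡ r x) →
                         ∀ xs → length (filterᵇ q (filterᵇ p xs)) ≡ length (filterᵇ r xs)
length-filterᵇ-filterᵇ p q r p∧q≡r []       = refl
length-filterᵇ-filterᵇ p q r p∧q≡r (x ∷ xs) rewrite sym (p∧q≡r x) with p x
... | false = length-filterᵇ-filterᵇ p q r p∧q≡r xs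
... | true with q x
...   | true  = cong suc (length-filterᵇ-filterᵇ p q r p∧q≡r xs)
...   | false = length-filterᵇ-filterᵇ p q r p∧q≡r xs

length-filterᵇ-tabulate : ∀ {A : Set} {n} (p : A → Bool) (g : Fin n → A) →
                          length (filterᵇ p (tabulate g)) ≡ ∑[ i < n ] ⟦ p (g i) ⟧
length-filterᵇ-tabulate {n = zero}  p g = refl
length-filterᵇ-tabulate {n = suc n} p g =
  trans (length-filterᵇ-∷ p (g zero) _) (cong (⟦ p (g zero) ⟧ +_) (length-filterᵇ-tabulate p (g ∘ suc)))

length-filterᵇ-cartesianProduct : ∀ {A B : Set} {n} (p : A × B → Bool) (g : Fin n → A) (ys : List B) →
  length (filterᵇ p (cartesianProduct (tabulate g) ys)) ≡ ∑[ i < n ] length (filterᵇ (λ y → p (g i , y)) ys)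
length-filterᵇ-cartesianProduct {n = zero}  p g ys = refl
length-filterᵇ-cartesianProduct {n = suc n} p g ys =
  trans (length-filterᵇ-++ p (map (g zero ,_) ys) _)
        (cong₂ _+_ (length-filterᵇ-map p (g zero ,_) ys) (length-filterᵇ-cartesianProduct p (g ∘ suc) ys))

length-filterᵇ-allPairs : ∀ n (p : Fin n × Fin n → Bool) →
  length (filterᵇ p (cartesianProduct (allFin n) (allFin n))) ≡ ∑[ i < n ] ∑[ j < n ] ⟦ p (i , j) ⟧
length-filterᵇ-allPairs n p =
  trans (length-filterᵇ-cartesianProduct p id (allFin n))
        (sum-cong-≗ λ i → length-filterᵇ-tabulate (λ j → p (i , j)) id)

sum-map-+ : ∀ {A : Set} (g h : A → ℕ) xs →
            sum (map (λ x → g x + h x) xs) ≡ sum (map g xs) + sum (map h xs)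
sum-map-+ g h []       = refl
sum-map-+ g h (x ∷ xs) = trans (cong (g x + h x +_) (sum-map-+ g h xs)) (interchange (g x) (h x) _ _)
  where
  interchange : ∀ a b c d → a + b + (c + d) ≡ a + c + (b + d)
  interchange = solve-∀

sum-map-≤ : ∀ {A : Set} {g : A → ℕ} {b} {xs} → All (λ x → g x ≤ b) xs → sum (map g xs) ≤ length xs * b
sum-map-≤ []           = z≤n
sum-map-≤ (gx≤b ∷ all) = +-mono-≤ gx≤b (sum-map-≤ all)

sum-map-≤-but-one : ∀ {A : Set} {P : A → Set} {g : A → ℕ} {b} {xs} → Unique xs →
  (∀ {x y} → P x → P y → x ≡ y) → (∀ x → g x ≤ b ⊎ P x × g x ≤ suc b) →
  sum (map g xs) ≤ suc (length xs * b)
sum-map-≤-but-one {xs = []} _ _ _ = z≤n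
sum-map-≤-but-one {g = g} {b} {x ∷ xs} (x≢xs ∷ unique) P-unique bound with bound x
... | inj₁ gx≤b =
  ≤-trans (+-mono-≤ gx≤b (sum-map-≤-but-one unique P-unique bound)) (≤-reflexive (+-suc b _))
... | inj₂ (Px , gx≤sb) = +-mono-≤ gx≤sb (sum-map-≤ (All.map others-≤b x≢xs))
  where
  others-≤b : ∀ {y} → x ≢ y → g y ≤ b
  others-≤b {y} x≢y = [ id , (λ (Py , _) → contradiction (P-unique Px Py) x≢y) ] (bound y)

1≤∑⟦≟⟧ : ∀ {B : Set} (_≟_ : DecidableEquality B) {y} {bs} → y ∈ bs →
         1 ≤ sum (map (λ b → ⟦ does (y ≟ b) ⟧) bs)
1≤∑⟦≟⟧ _≟_ {y} (here refl) with y ≟ y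
... | yes _   = s≤s z≤n
... | no y≢y  = contradiction refl y≢y
1≤∑⟦≟⟧ _≟_ {y} {b ∷ _} (there y∈bs) = ≤-trans (1≤∑⟦≟⟧ _≟_ y∈bs) (m≤n+m _ ⟦ does (y ≟ b) ⟧)

module _ {A B : Set} (_≟_ : DecidableEquality B) (g : A → B) where

  fibre : B → List A → List A
  fibre b = filterᵇ (λ x → does (g x ≟ b))

  length-≤-∑-fibres : ∀ bs xs → (∀ {x} → x ∈ xs → g x ∈ bs) →
                      length xs ≤ sum (map (λ b → length (fibre b xs)) bs)
  length-≤-∑-fibres bs []       _     = z≤n
  length-≤-∑-fibres bs (x ∷ xs) g∈bs = begin
    suc (length xs)
      ≤⟨ +-mono-≤ (1≤∑⟦≟⟧ _≟_ (g∈bs (here refl))) (length-≤-∑-fibres bs xs (g∈bs ∘ there)) ⟩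
    sum (map (λ b → ⟦ does (g x ≟ b) ⟧) bs) + sum (map (λ b → length (fibre b xs)) bs)
      ≡⟨ sum-map-+ _ _ bs ⟨
    sum (map (λ b → ⟦ does (g x ≟ b) ⟧ + length (fibre b xs)) bs)
      ≡⟨ cong sum (map-cong (λ b → length-filterᵇ-∷ _ x xs) bs) ⟨
    sum (map (λ b → length (fibre b (x ∷ xs))) bs) ∎
    where open ℕ-Reasoning

Unique-⊆⇒length≤ : ∀ {A : Set} {xs ys : List A} → Unique xs → (∀ {x} → x ∈ xs → x ∈ ys) →
                   length xs ≤ length ys
Unique-⊆⇒length≤ {xs = []} _ _ = z≤n
Unique-⊆⇒length≤ {xs = x ∷ xs} (x∉xs ∷ unique) xs⊆ys with ∈-∃++ (xs⊆ys (here refl))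
... | us , vs , refl =
  ≤-trans (s≤s (Unique-⊆⇒length≤ unique xs⊆us++vs)) (≤-reflexive (sym (length-++-sucʳ us x vs)))
  where
  xs⊆us++vs : ∀ {y} → y ∈ xs → y ∈ us ++ vs
  xs⊆us++vs {y} y∈xs with ∈-++⁻ us (xs⊆ys (there y∈xs))
  ... | inj₁ y∈us          = ∈-++⁺ˡ y∈us
  ... | inj₂ (here refl)   = contradiction refl (All.lookup x∉xs y∈xs)
  ... | inj₂ (there y∈vs)  = ∈-++⁺ʳ us y∈vs

degree : ∀ {n} → SimpleGraph n → Fin n → ℕ
degree {n} G i = ∑[ j < n ] ⟦ adj G i j ⟧

numEdges-∑ : ∀ {n} (G : SimpleGraph n) →
             numEdges G ≡ ∑[ i < n ] ∑[ j < n ] ⟦ (toℕ i <ᵇ toℕ j) ∧ adj G i j ⟧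
numEdges-∑ {n} G = length-filterᵇ-allPairs n _

handshake : ∀ {n} (G : SimpleGraph n) → 2 * numEdges G ≤ ∑[ i < n ] degree G i
handshake {n} G = begin
  2 * numEdges G                                  ≡⟨ cong (λ e → e + (e + 0)) (numEdges-∑ G) ⟩
  ∑ᵢ∑ⱼ A + (∑ᵢ∑ⱼ A + 0)                          ≡⟨ cong (∑ᵢ∑ⱼ A +_) (trans (+-identityʳ _) (∑-comm A)) ⟩
  ∑ᵢ∑ⱼ A + ∑[ i < n ] ∑[ j < n ] A j i           ≡⟨ ∑-distrib-+ (λ i → ∑[ j < n ] A i j) _ ⟨
  ∑[ i < n ] (∑[ j < n ] A i j + ∑[ j < n ] A j i) ≡⟨ sum-cong-≗ (λ i → ∑-distrib-+ (A i) _) ⟨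
  ∑[ i < n ] ∑[ j < n ] (A i j + A j i)          ≤⟨ ∑-mono-≤ (λ i → ∑-mono-≤ (λ j → both-orders i j)) ⟩
  ∑[ i < n ] degree G i                          ∎
  where
  open ℕ-Reasoning
  A : Fin n → Fin n → ℕ
  A i j = ⟦ (toℕ i <ᵇ toℕ j) ∧ adj G i j ⟧
  ∑ᵢ∑ⱼ : (Fin n → Fin n → ℕ) → ℕ
  ∑ᵢ∑ⱼ B = ∑[ i < n ] ∑[ j < n ] B i j
  both-orders : ∀ i j → A i j + A j i ≤ ⟦ adj G i j ⟧
  both-orders i j rewrite adj-sym G j i = ⟦∧⟧+⟦∧⟧≤⟦⟧ (toℕ i <ᵇ toℕ j) (toℕ j <ᵇ toℕ i) (adj G i j)
    λ i<j j<i → <-asym (<ᵇ⇒< (toℕ i) (toℕ j) i<j) (<ᵇ⇒< (toℕ j) (toℕ i) j<i)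

IsMatching : ∀ {n} → SimpleGraph n → Set
IsMatching G = ∀ i → degree G i ≤ 1

NoIsolatedVertex : ∀ {n} → SimpleGraph n → Set
NoIsolatedVertex G = ∀ i → ∃ λ j → T (adj G i j)

matching-numEdges-≤ : ∀ {n} (G : SimpleGraph n) → IsMatching G → 2 * numEdges G ≤ n
matching-numEdges-≤ G matching = ≤-trans (handshake G) (∑-≤1⇒≤n matching)

matching-numEdges-<-or-perfect : ∀ {n} (G : SimpleGraph n) → IsMatching G →
                                 2 * numEdges G < n ⊎ NoIsolatedVertex G
matching-numEdges-<-or-perfect G matching with any? (λ i → degree G i ≟ℕ 0)
... | yes (i , isolated) = inj₁ (≤-<-trans (handshake G) (∑-≤1⇒<n matching i isolated))
... | no none            = inj₂ λ i → ∑⟦⟧≢0⇒∃ (adj G i) (λ isolated → none (i , isolated))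

edgeSum : ∀ {n} → (Fin n → ℤ) → Fin n × Fin n → ℤ
edgeSum f (i , j) = f i ℤ.+ f j

sumSet : ∀ {n} → SimpleGraph n → (Fin n → ℤ) → List ℤ
sumSet G f = deduplicate _≟ℤ_ (map (edgeSum f) (edges G))

sumClass : ∀ {n} → SimpleGraph n → (Fin n → ℤ) → ℤ → SimpleGraph n
sumClass G f t = record
  { adj    = λ i j → adj G i j ∧ does (f i ℤ.+ f j ≟ℤ t)
  ; sym    = λ i j → cong₂ _∧_ (adj-sym G i j) (cong (λ s → does (s ≟ℤ t)) (ℤₚ.+-comm (f i) (f j)))
  ; irrefl = λ i → cong (_∧ _) (irrefl G i)
  }

numEdges-sumClass : ∀ {n} (G : SimpleGraph n) f t →
                    numEdges (sumClass G f t) ≡ length (fibre _≟ℤ_ (edgeSum f) t (edges G))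
numEdges-sumClass {n} G f t =
  sym (length-filterᵇ-filterᵇ _ _ _ (λ (i , j) → ∧-assoc (toℕ i <ᵇ toℕ j) (adj G i j) _)
                              (cartesianProduct (allFin n) (allFin n)))

numEdges-≤-∑-sumClass : ∀ {n} (G : SimpleGraph n) f →
                        numEdges G ≤ sum (map (numEdges ∘ sumClass G f) (sumSet G f))
numEdges-≤-∑-sumClass G f = begin
  numEdges G
    ≤⟨ length-≤-∑-fibres _≟ℤ_ (edgeSum f) (sumSet G f) (edges G) (∈-deduplicate⁺ _≟ℤ_ ∘ ∈-map⁺ (edgeSum f)) ⟩
  sum (map (λ t → length (fibre _≟ℤ_ (edgeSum f) t (edges G))) (sumSet G f))
    ≡⟨ cong sum (map-cong (numEdges-sumClass G f) (sumSet G f)) ⟨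
  sum (map (numEdges ∘ sumClass G f) (sumSet G f)) ∎
  where open ℕ-Reasoning

sumClass-sum : ∀ {n} (G : SimpleGraph n) f t {i j} → T (adj (sumClass G f t) i j) → f i ℤ.+ f j ≡ t
sumClass-sum G f t {i} {j} i~j = T-does (f i ℤ.+ f j ≟ℤ t) (proj₂ (Equivalence.to (T-∧ {adj G i j}) i~j))

sumClass-isMatching : ∀ {n} (G : SimpleGraph n) {f} → Injective _≡_ _≡_ f →
                      ∀ t → IsMatching (sumClass G f t)
sumClass-isMatching G {f} f-inj t i = ∑⟦⟧≤1 (adj (sumClass G f t) i) λ {j} {k} i~j i~k →
  f-inj (∙-cancelˡ (f i) (f j) (f k) (trans (sumClass-sum G f t i~j) (sym (sumClass-sum G f t i~k))))

PairedAt : ∀ {n} → (Fin n → ℤ) → ℤ → Set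
PairedAt f s = ∀ i → ∃ λ j → f i ℤ.+ f j ≡ s

pairedAt-sumClass : ∀ {n} (G : SimpleGraph n) f t → NoIsolatedVertex (sumClass G f t) → PairedAt f t
pairedAt-sumClass G f t perfect i =
  let j , i~j = perfect i in j , sumClass-sum G f t i~j

pairedAt⇒≡max+min : ∀ {n} (f : Fin n → ℤ) {lo hi : Fin n} → (∀ v → f lo ℤ.≤ f v) → (∀ v → f v ℤ.≤ f hi) →
                    ∀ {s} → PairedAt f s → s ≡ f hi ℤ.+ f lo
pairedAt⇒≡max+min f {lo} {hi} lo≤ ≤hi {s} paired = ℤₚ.≤-antisym s≤ ≤s
  where
  open ℤₚ.≤-Reasoning
  s≤ : s ℤ.≤ f hi ℤ.+ f lo
  s≤ = let u , sum≡s = paired lo in begin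
    s               ≡⟨ sum≡s ⟨
    f lo ℤ.+ f u    ≤⟨ ℤₚ.+-monoʳ-≤ (f lo) (≤hi u) ⟩
    f lo ℤ.+ f hi   ≡⟨ ℤₚ.+-comm (f lo) (f hi) ⟩
    f hi ℤ.+ f lo   ∎
  ≤s : f hi ℤ.+ f lo ℤ.≤ s
  ≤s = let w , sum≡s = paired hi in begin
    f hi ℤ.+ f lo   ≤⟨ ℤₚ.+-monoʳ-≤ (f hi) (lo≤ w) ⟩
    f hi ℤ.+ f w    ≡⟨ sum≡s ⟩
    s               ∎

pairedAt-unique : ∀ {n} (f : Fin n → ℤ) → Fin n → ∀ {s t} → PairedAt f s → PairedAt f t → s ≡ t
pairedAt-unique {n} f v₀ paired-s paired-t =
  trans (pairedAt⇒≡max+min f lo≤ ≤hi paired-s) (sym (pairedAt⇒≡max+min f lo≤ ≤hi paired-t))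
  where
  lo≤ : ∀ v → f (argmin f v₀ (allFin n)) ℤ.≤ f v
  lo≤ v = All.lookup (f[argmin]≤f[xs] v₀ (allFin n)) (∈-allFin v)
  ≤hi : ∀ v → f v ℤ.≤ f (argmax f v₀ (allFin n))
  ≤hi v = All.lookup (f[xs]≤f[argmax] v₀ (allFin n)) (∈-allFin v)

half-≤-odd : ∀ {e m} → 2 * e ≤ suc (m * 2) → e ≤ m
half-≤-odd {e} {m} 2e≤ = ≤-pred (*-cancelʳ-< 2 e (suc m) (s≤s (subst (_≤ suc (m * 2)) (*-comm 2 e) 2e≤)))

half-≤-even : ∀ {e m} → 2 * e ≤ m * 2 → e ≤ m
half-≤-even {e} {m} 2e≤ = *-cancelʳ-≤ e m 2 (subst (_≤ m * 2) (*-comm 2 e) 2e≤)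

numEdges-≤-odd : ∀ m (G : SimpleGraph (suc (m * 2))) {f} → Injective _≡_ _≡_ f →
                 numEdges G ≤ sumSetSize G f * m
numEdges-≤-odd m G {f} f-inj =
  ≤-trans (numEdges-≤-∑-sumClass G f) (sum-map-≤ {xs = sumSet G f} (All.tabulate λ {t} _ → class-bound t))
  where
  class-bound : ∀ t → numEdges (sumClass G f t) ≤ m
  class-bound t = half-≤-odd (matching-numEdges-≤ (sumClass G f t) (sumClass-isMatching G f-inj t))

numEdges-≤-even : ∀ m (G : SimpleGraph (suc m * 2)) {f} → Injective _≡_ _≡_ f →
                  numEdges G ≤ suc (sumSetSize G f * m)
numEdges-≤-even m G {f} f-inj =
  ≤-trans (numEdges-≤-∑-sumClass G f)
          (sum-map-≤-but-one (deduplicate-! _≟ℤ_ (map (edgeSum f) (edges G))) (pairedAt-unique f zero) class-bound)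
  where
  class-bound : ∀ t → numEdges (sumClass G f t) ≤ m ⊎ PairedAt f t × numEdges (sumClass G f t) ≤ suc m
  class-bound t with matching-numEdges-<-or-perfect (sumClass G f t) (sumClass-isMatching G f-inj t)
  ... | inj₁ 2e<n    = inj₁ (half-≤-odd (≤-pred 2e<n))
  ... | inj₂ perfect = inj₂ (pairedAt-sumClass G f t perfect ,
                             half-≤-even (matching-numEdges-≤ (sumClass G f t) (sumClass-isMatching G f-inj t)))

adj-of-∈-edges : ∀ {n} (G : SimpleGraph n) {i j} → (i , j) ∈ edges G → T (adj G i j)
adj-of-∈-edges {n} G {i} {j} e∈ =
  proj₂ (Equivalence.to (T-∧ {toℕ i <ᵇ toℕ j}) (proj₂ (∈-filter⁻ _ {xs = cartesianProduct (allFin n) (allFin n)} e∈)))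

window : ℤ → List ℤ
window c = ℤ.pred c ∷ c ∷ ℤ.suc c ∷ []

record ThreeSumLabelling (n : ℕ) : Set where
  field
    graph           : SimpleGraph n
    label           : Fin n → ℤ
    label-injective : Injective _≡_ _≡_ label
    top bottom      : Fin n
    ≤top            : ∀ v → label v ℤ.≤ label top
    bottom≤         : ∀ v → label bottom ℤ.≤ label v
    edge-sums       : ∀ i j → T (adj graph i j) →
                      label i ℤ.+ label j ∈ window (label top ℤ.+ label bottom)

open ThreeSumLabelling

sumSetSize-≤-3 : ∀ {n} (L : ThreeSumLabelling n) → sumSetSize (graph L) (label L) ≤ 3
sumSetSize-≤-3 L =
  Unique-⊆⇒length≤ (deduplicate-! _≟ℤ_ (map (edgeSum (label L)) (edges (graph L)))) ⊆window
  where
  ⊆window : ∀ {x} → x ∈ sumSet (graph L) (label L) → x ∈ window (label L (top L) ℤ.+ label L (bottom L))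
  ⊆window x∈ with ∈-map⁻ (edgeSum (label L)) (∈-deduplicate⁻ _≟ℤ_ _ x∈)
  ... | (i , j) , e∈edges , refl = edge-sums L i j (adj-of-∈-edges (graph L) e∈edges)

-- 0F and 1F are the new vertices and suc (suc v) is the old vertex v; the new edges form the path
-- u - 0F - 1F - w.
pathAdj : ∀ {n} → (Fin n → Fin n → Bool) → Fin n → Fin n → Fin (2 + n) → Fin (2 + n) → Bool
pathAdj a u w 0F            1F            = true
pathAdj a u w 1F            0F            = true
pathAdj a u w 0F            (suc (suc j)) = does (j ≟ᶠ u)
pathAdj a u w (suc (suc i)) 0F            = does (i ≟ᶠ u)
pathAdj a u w 1F            (suc (suc j)) = does (j ≟ᶠ w)
pathAdj a u w (suc (suc i)) 1F            = does (i ≟ᶠ w)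
pathAdj a u w (suc (suc i)) (suc (suc j)) = a i j
pathAdj a u w _             _             = false

addPath : ∀ {n} → SimpleGraph n → Fin n → Fin n → SimpleGraph (2 + n)
addPath {n} G u w = record { adj = pathAdj (adj G) u w ; sym = symmetric ; irrefl = irreflexive }
  where
  symmetric : ∀ i j → pathAdj (adj G) u w i j ≡ pathAdj (adj G) u w j i
  symmetric 0F            0F            = refl
  symmetric 0F            1F            = refl
  symmetric 0F            (suc (suc j)) = refl
  symmetric 1F            0F            = refl
  symmetric 1F            1F            = refl
  symmetric 1F            (suc (suc j)) = refl
  symmetric (suc (suc i)) 0F            = refl
  symmetric (suc (suc i)) 1F            = refl
  symmetric (suc (suc i)) (suc (suc j)) = adj-sym G i j
  irreflexive : ∀ i → pathAdj (adj G) u w i i ≡ false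
  irreflexive 0F            = refl
  irreflexive 1F            = refl
  irreflexive (suc (suc i)) = irrefl G i

numEdges-addPath : ∀ {n} (G : SimpleGraph n) u w → numEdges (addPath G u w) ≡ 3 + numEdges G
numEdges-addPath {n} G u w = begin
  numEdges (addPath G u w)
    ≡⟨ numEdges-∑ (addPath G u w) ⟩
  -- rows 0F and 1F of the double sum hold the new edges, the other rows reduce to those of G
  suc (∑[ j < n ] ⟦ does (j ≟ᶠ u) ⟧) + (∑[ j < n ] ⟦ does (j ≟ᶠ w) ⟧ + ∑ᵢ∑ⱼ)
    ≡⟨ cong₂ (λ a b → suc a + (b + ∑ᵢ∑ⱼ)) (∑⟦≟⟧≡1 u) (∑⟦≟⟧≡1 w) ⟩
  3 + ∑ᵢ∑ⱼ
    ≡⟨ cong (3 +_) (numEdges-∑ G) ⟨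
  3 + numEdges G ∎
  where
  open ≡-Reasoning
  ∑ᵢ∑ⱼ : ℕ
  ∑ᵢ∑ⱼ = ∑[ i < n ] ∑[ j < n ] ⟦ (toℕ i <ᵇ toℕ j) ∧ adj G i j ⟧

extend : ∀ {n} → ThreeSumLabelling n → ThreeSumLabelling (2 + n)
extend {n} L = record
  { graph           = addPath (graph L) (top L) (bottom L)
  ; label           = label′
  ; label-injective = injective
  ; top             = 1F
  ; bottom          = 0F
  ; ≤top            = ≤top′
  ; bottom≤         = bottom≤′
  ; edge-sums       = λ i j i~j →
                        subst (λ c → label′ i ℤ.+ label′ j ∈ window c) (sym c′≡c) (edge-sums′ i j i~j)
  }
  where
  t b c : ℤ
  t = label L (top L)
  b = label L (bottom L)
  c = t ℤ.+ b

  label′ : Fin (2 + n) → ℤ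
  label′ 0F            = ℤ.pred b
  label′ 1F            = ℤ.suc t
  label′ (suc (suc v)) = label L v

  below : ∀ v → ℤ.pred b ℤ.< label L v
  below v = ℤₚ.i≤pred[j]⇒i<j (ℤₚ.pred-mono (bottom≤ L v))
  above : ∀ v → label L v ℤ.< ℤ.suc t
  above v = ℤₚ.suc[i]≤j⇒i<j (ℤₚ.suc-mono (≤top L v))
  new-below-new : ℤ.pred b ℤ.< ℤ.suc t
  new-below-new = ℤₚ.<-trans (below (top L)) (above (top L))

  injective : Injective _≡_ _≡_ label′
  injective {0F}          {0F}          _ = refl
  injective {0F}          {1F}          e = contradiction e (ℤₚ.<⇒≢ new-below-new)
  injective {0F}          {suc (suc v)} e = contradiction e (ℤₚ.<⇒≢ (below v))
  injective {1F}          {0F}          e = contradiction (sym e) (ℤₚ.<⇒≢ new-below-new)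
  injective {1F}          {1F}          _ = refl
  injective {1F}          {suc (suc v)} e = contradiction (sym e) (ℤₚ.<⇒≢ (above v))
  injective {suc (suc v)} {0F}          e = contradiction (sym e) (ℤₚ.<⇒≢ (below v))
  injective {suc (suc v)} {1F}          e = contradiction e (ℤₚ.<⇒≢ (above v))
  injective {suc (suc v)} {suc (suc w)} e with refl ← label-injective L e = refl

  ≤top′ : ∀ v → label′ v ℤ.≤ ℤ.suc t
  ≤top′ 0F            = ℤₚ.<⇒≤ new-below-new
  ≤top′ 1F            = ℤₚ.≤-refl
  ≤top′ (suc (suc v)) = ℤₚ.<⇒≤ (above v)

  bottom≤′ : ∀ v → ℤ.pred b ℤ.≤ label′ v
  bottom≤′ 0F            = ℤₚ.≤-refl
  bottom≤′ 1F            = ℤₚ.<⇒≤ new-below-new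
  bottom≤′ (suc (suc v)) = ℤₚ.<⇒≤ (below v)

  c′≡c : ℤ.suc t ℤ.+ ℤ.pred b ≡ c
  c′≡c = shift t b
    where
    shift : ∀ x y → (1ℤ ℤ.+ x) ℤ.+ (-1ℤ ℤ.+ y) ≡ x ℤ.+ y
    shift = ℤ-solve-∀

  pred-c : ℤ.pred b ℤ.+ t ≡ ℤ.pred c
  pred-c = shift t b
    where
    shift : ∀ x y → (-1ℤ ℤ.+ y) ℤ.+ x ≡ -1ℤ ℤ.+ (x ℤ.+ y)
    shift = ℤ-solve-∀

  suc-c : ℤ.suc t ℤ.+ b ≡ ℤ.suc c
  suc-c = ℤₚ.+-assoc 1ℤ t b

  mirror : ∀ i j → label′ i ℤ.+ label′ j ∈ window c → label′ j ℤ.+ label′ i ∈ window c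
  mirror i j = subst (_∈ window c) (ℤₚ.+-comm (label′ i) (label′ j))

  edge-sums′ : ∀ i j → T (adj (addPath (graph L) (top L) (bottom L)) i j) →
               label′ i ℤ.+ label′ j ∈ window c
  edge-sums′ 0F 1F _ = mirror 1F 0F (there (here c′≡c))
  edge-sums′ 1F 0F _ = there (here c′≡c)
  edge-sums′ 0F (suc (suc j)) j~top with refl ← T-does (j ≟ᶠ top L) j~top =
    here pred-c
  edge-sums′ (suc (suc i)) 0F i~top with refl ← T-does (i ≟ᶠ top L) i~top =
    mirror 0F (suc (suc (top L))) (here pred-c)
  edge-sums′ 1F (suc (suc j)) j~bottom with refl ← T-does (j ≟ᶠ bottom L) j~bottom =
    there (there (here suc-c))
  edge-sums′ (suc (suc i)) 1F i~bottom with refl ← T-does (i ≟ᶠ bottom L) i~bottom =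
    mirror 1F (suc (suc (bottom L))) (there (there (here suc-c)))
  edge-sums′ (suc (suc i)) (suc (suc j)) i~j = edge-sums L i j i~j

numEdges-extend : ∀ {n} (L : ThreeSumLabelling n) → numEdges (graph (extend L)) ≡ 3 + numEdges (graph L)
numEdges-extend L = numEdges-addPath (graph L) (top L) (bottom L)

K₁ : ThreeSumLabelling 1
K₁ = record
  { graph           = record { adj = λ _ _ → false ; sym = λ _ _ → refl ; irrefl = λ _ → refl }
  ; label           = λ _ → 0ℤ
  ; label-injective = λ { {0F} {0F} _ → refl }
  ; top             = 0F
  ; bottom          = 0F
  ; ≤top            = λ _ → ℤₚ.≤-refl
  ; bottom≤         = λ _ → ℤₚ.≤-refl
  ; edge-sums       = λ _ _ ()
  }

K₂ : ThreeSumLabelling 2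
K₂ = record
  { graph           = record { adj = k₂ ; sym = symmetric ; irrefl = λ { 0F → refl ; 1F → refl } }
  ; label           = toℤ
  ; label-injective = λ { {0F} {0F} _ → refl ; {1F} {1F} _ → refl }
  ; top             = 1F
  ; bottom          = 0F
  ; ≤top            = λ { 0F → ℤ.+≤+ z≤n ; 1F → ℤₚ.≤-refl }
  ; bottom≤         = λ { 0F → ℤₚ.≤-refl ; 1F → ℤ.+≤+ z≤n }
  ; edge-sums       = λ { 0F 1F _ → there (here refl) ; 1F 0F _ → there (here refl) }
  }
  where
  k₂ : Fin 2 → Fin 2 → Bool
  k₂ 0F 1F = true
  k₂ 1F 0F = true
  k₂ _  _  = false
  symmetric : ∀ i j → k₂ i j ≡ k₂ j i
  symmetric 0F 0F = refl
  symmetric 0F 1F = refl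
  symmetric 1F 0F = refl
  symmetric 1F 1F = refl
  toℤ : Fin 2 → ℤ
  toℤ i = ℤ.+ toℕ i

oddFamily : ∀ m → ThreeSumLabelling (suc (m * 2))
oddFamily zero    = K₁
oddFamily (suc m) = extend (oddFamily m)

evenFamily : ∀ m → ThreeSumLabelling (suc m * 2)
evenFamily zero    = K₂
evenFamily (suc m) = extend (evenFamily m)

numEdges-oddFamily : ∀ m → numEdges (graph (oddFamily m)) ≡ m * 3
numEdges-oddFamily zero    = refl
numEdges-oddFamily (suc m) =
  trans (numEdges-extend (oddFamily m)) (cong (3 +_) (numEdges-oddFamily m))

numEdges-evenFamily : ∀ m → numEdges (graph (evenFamily m)) ≡ suc (m * 3)
numEdges-evenFamily zero    = refl
numEdges-evenFamily (suc m) =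
  trans (numEdges-extend (evenFamily m)) (cong (3 +_) (numEdges-evenFamily m))

oddFamily-tight : ∀ m → 2 * numEdges (graph (oddFamily m)) + 3 ≡ 3 * suc (m * 2)
oddFamily-tight m = trans (cong (λ e → 2 * e + 3) (numEdges-oddFamily m)) (arith m)
  where
  arith : ∀ m → 2 * (m * 3) + 3 ≡ 3 * suc (m * 2)
  arith = solve-∀

evenFamily-tight : ∀ m → 2 * numEdges (graph (evenFamily m)) + 4 ≡ 3 * (suc m * 2)
evenFamily-tight m = trans (cong (λ e → 2 * e + 4) (numEdges-evenFamily m)) (arith m)
  where
  arith : ∀ m → 2 * suc (m * 3) + 4 ≡ 3 * (suc m * 2)
  arith = solve-∀

hasSumIndex-3 : ∀ {n} (L : ThreeSumLabelling n) →
                (∀ g → Injective _≡_ _≡_ g → 3 ≤ sumSetSize (graph L) g) → HasSumIndex (graph L) 3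
hasSumIndex-3 L 3≤ =
  (label L , label-injective L , ≤-antisym (sumSetSize-≤-3 L) (3≤ (label L) (label-injective L))) , 3≤

oddFamily-hasSumIndex-3 : ∀ m → HasSumIndex (graph (oddFamily (suc m))) 3
oddFamily-hasSumIndex-3 m = hasSumIndex-3 (oddFamily (suc m)) λ g g-inj →
  *-cancelʳ-≤ 3 (sumSetSize G g) (suc m)
    (subst (_≤ sumSetSize G g * suc m) (trans (numEdges-oddFamily (suc m)) (*-comm (suc m) 3))
           (numEdges-≤-odd (suc m) G g-inj))
  where
  G : SimpleGraph (suc (suc m * 2))
  G = graph (oddFamily (suc m))

evenFamily-hasSumIndex-3 : ∀ m → HasSumIndex (graph (evenFamily (suc m))) 3
evenFamily-hasSumIndex-3 m = hasSumIndex-3 (evenFamily (suc m)) λ g g-inj →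
  *-cancelʳ-≤ 3 (sumSetSize G g) (suc m)
    (subst (_≤ sumSetSize G g * suc m) (*-comm (suc m) 3)
           (≤-pred (subst (_≤ suc (sumSetSize G g * suc m)) (numEdges-evenFamily (suc m))
                          (numEdges-≤-even (suc m) G g-inj))))
  where
  G : SimpleGraph (suc (suc m) * 2)
  G = graph (evenFamily (suc m))

data Parity : ℕ → Set where
  even : ∀ m → Parity (m * 2)
  odd  : ∀ m → Parity (suc (m * 2))

parity : ∀ n → Parity n
parity zero = even 0
parity (suc n) with parity n
... | even m = odd m
... | odd m  = even (suc m)

even≢odd : ∀ m → m * 2 % 2 ≢ 1
even≢odd m even≡1 = contradiction (trans (sym (m*n%n≡0 m 2)) even≡1) λ ()

odd≢even : ∀ m → suc (m * 2) % 2 ≢ 0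
odd≢even m odd≡0 = contradiction (trans (sym ([m+kn]%n≡m%n 1 m 2)) odd≡0) λ ()

upper-bound-odd : ∀ m (G : SimpleGraph (suc (m * 2))) → HasSumIndex G 3 →
                  2 * numEdges G + 3 ≤ 3 * suc (m * 2)
upper-bound-odd m G ((f , f-inj , s≡3) , _) = begin
  2 * numEdges G + 3 ≤⟨ +-monoˡ-≤ 3 (*-monoʳ-≤ 2 bound) ⟩
  2 * (3 * m) + 3    ≡⟨ arith m ⟩
  3 * suc (m * 2)    ∎
  where
  open ℕ-Reasoning
  bound : numEdges G ≤ 3 * m
  bound = subst (λ s → numEdges G ≤ s * m) s≡3 (numEdges-≤-odd m G f-inj)
  arith : ∀ m → 2 * (3 * m) + 3 ≡ 3 * suc (m * 2)
  arith = solve-∀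

upper-bound-even : ∀ m (G : SimpleGraph (suc m * 2)) → HasSumIndex G 3 →
                   2 * numEdges G + 4 ≤ 3 * (suc m * 2)
upper-bound-even m G ((f , f-inj , s≡3) , _) = begin
  2 * numEdges G + 4  ≤⟨ +-monoˡ-≤ 4 (*-monoʳ-≤ 2 bound) ⟩
  2 * suc (3 * m) + 4 ≡⟨ arith m ⟩
  3 * (suc m * 2)     ∎
  where
  open ℕ-Reasoning
  bound : numEdges G ≤ suc (3 * m)
  bound = subst (λ s → numEdges G ≤ suc (s * m)) s≡3 (numEdges-≤-even m G f-inj)
  arith : ∀ m → 2 * suc (3 * m) + 4 ≡ 3 * (suc m * 2)
  arith = solve-∀

upper-bound : (n : ℕ) (G : SimpleGraph n) → HasSumIndex G 3 →
              (n % 2 ≡ 0 → 2 * numEdges G + 4 ≤ 3 * n) × (n % 2 ≡ 1 → 2 * numEdges G + 3 ≤ 3 * n)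
upper-bound n G S≡3 with parity n
-- On no vertices there are no edges, so the sum set is empty.
upper-bound .0 G ((_ , _ , ()) , _) | even zero
... | even (suc m) = (λ _ → upper-bound-even m G S≡3) , (λ n-odd → contradiction n-odd (even≢odd (suc m)))
... | odd m        = (λ n-even → contradiction n-even (odd≢even m)) , (λ _ → upper-bound-odd m G S≡3)

extremal-graphs : (n : ℕ) → 3 ≤ n → Σ (SimpleGraph n) λ G → HasSumIndex G 3
                  × (n % 2 ≡ 0 → 2 * numEdges G + 4 ≡ 3 * n) × (n % 2 ≡ 1 → 2 * numEdges G + 3 ≡ 3 * n)
extremal-graphs n 3≤n with parity n
... | even (suc (suc m)) =
  graph (evenFamily (suc m)) , evenFamily-hasSumIndex-3 m ,
  (λ _ → evenFamily-tight (suc m)) , (λ n-odd → contradiction n-odd (even≢odd (suc (suc m))))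
... | odd (suc m) =
  graph (oddFamily (suc m)) , oddFamily-hasSumIndex-3 m ,
  (λ n-even → contradiction n-even (odd≢even (suc m))) , (λ _ → oddFamily-tight (suc m))
... | even 0 = contradiction 3≤n λ ()
... | even 1 = contradiction 3≤n λ { (s≤s (s≤s ())) }
... | odd 0  = contradiction 3≤n λ { (s≤s ()) }

theorem3p1 :
    ((n : ℕ) (G : SimpleGraph n) → HasSumIndex G 3 →
      (n % 2 ≡ 0 → 2 * numEdges G + 4 ≤ 3 * n)
      × (n % 2 ≡ 1 → 2 * numEdges G + 3 ≤ 3 * n))
    × ((n : ℕ) → 3 ≤ n →
      Σ (SimpleGraph n) λ G → HasSumIndex G 3
        × (n % 2 ≡ 0 → 2 * numEdges G + 4 ≡ 3 * n)
        × (n % 2 ≡ 1 → 2 * numEdges G + 3 ≡ 3 * n))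
theorem3p1 = upper-bound , extremal-graphs
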